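{- For every $n\geq 3$, the directed cycle $C_n$ admits neither an SAML nor an SVML.
   Context: The directed cycle (dicycle) $C_n$, $n\geq 3$, has vertices $v_1,\ldots,v_n$ and arcs $v_iv_{i+1}$ ($1\le i\le n-1$) and $v_nv_1$. For a digraph $G=(V,A)$, a total labeling is a bijection $\lambda:V\cup A\to\{1,2,\ldots,|V|+|A|\}$. For an arc $xy$ (tail $x$, head $y$), $wt^-(xy)=\lambda(xy)+\lambda(y)-\lambda(x)$; for a vertex $x$, $wt^-(x)=\lambda(x)+\sum_{yx\in A}\lambda(yx)-\sum_{xy\in A}\lambda(xy)$. An SAML is a total labeling for which $wt^-(xy)$ is the same integer for all arcs; an SVML is a total labeling for which $wt^-(x)$ is the same integer for all vertices. -}

module Defs where

open import Data.Nat using (ℕ; zero; suc; _+_)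
open import Data.Nat.DivMod using (_mod_)
open import Data.Fin using (Fin; toℕ; _≟_)
open import Data.Integer as ℤ using (ℤ)
open import Data.Sum using (_⊎_; inj₁; inj₂)
open import Data.Product using (Σ; ∃; _,_)
open import Function.Bundles using (Bijection)
open import Relation.Binary.PropositionalEquality using (_≡_)
open import Relation.Nullary.Decidable using (does)
open import Data.Bool using (if_then_else_)

record Digraph : Set where
  field
    nV nA : ℕ
    tail head : Fin nA → Fin nV
open Digraph public

Elem : Digraph → Set
Elem G = Fin (nV G) ⊎ Fin (nA G)

-- A total labeling: bijection V ∪ A → {1,…,|V|+|A|}, with Fin (|V|+|A|)
-- representing {1,…,|V|+|A|} via i ↦ toℕ i + 1.
TotalLabeling : Digraph → Set
TotalLabeling G = Bijection (≡-setoid (Elem G)) (≡-setoid (Fin (nV G + nA G)))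
  where open import Relation.Binary.PropositionalEquality using () renaming (setoid to ≡-setoid)

label : (G : Digraph) → TotalLabeling G → Elem G → ℤ
label G f e = ℤ.+ suc (toℕ (Bijection.to f e))

sumFin : (n : ℕ) → (Fin n → ℤ) → ℤ
sumFin zero    g = ℤ.0ℤ
sumFin (suc n) g = g Fin.zero ℤ.+ sumFin n (λ i → g (Fin.suc i))
  where import Data.Fin as Fin

arcWt : (G : Digraph) → TotalLabeling G → Fin (nA G) → ℤ
arcWt G f a = (label G f (inj₂ a) ℤ.+ label G f (inj₁ (head G a))) ℤ.- label G f (inj₁ (tail G a))

vertexWt : (G : Digraph) → TotalLabeling G → Fin (nV G) → ℤ
vertexWt G f x =
  (label G f (inj₁ x)
    ℤ.+ sumFin (nA G) (λ a → if does (head G a ≟ x) then label G f (inj₂ a) else ℤ.0ℤ))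
    ℤ.- sumFin (nA G) (λ a → if does (tail G a ≟ x) then label G f (inj₂ a) else ℤ.0ℤ)

SAML : Digraph → Set
SAML G = Σ (TotalLabeling G) λ f → ∃ λ (k : ℤ) → ∀ a → arcWt G f a ≡ k

SVML : Digraph → Set
SVML G = Σ (TotalLabeling G) λ f → ∃ λ (k : ℤ) → ∀ x → vertexWt G f x ≡ k

next : {n : ℕ} → Fin n → Fin n
next {suc m} i = suc (toℕ i) mod suc m

-- Directed cycle C_n: vertex v_{i+1} is i : Fin n; arc i goes from v_{i+1} to v_{i+2}
-- (indices mod n), i.e. arcs v_1v_2, …, v_{n-1}v_n, v_nv_1.
dicycle : ℕ → Digraph
dicycle n = record { nV = n ; nA = n ; tail = λ i → i ; head = next }

-- Both conditions say that the labels satisfy a balance equation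
-- Y p + X (s p) = k + X p along the cycle, where s is a cyclic shift: for an
-- SAML, X are the vertex labels, Y the arc labels and s the successor; for an
-- SVML, X are the arc labels, Y the vertex labels and s the predecessor.
-- Where X increases along s (just before its maximum) the equation gives
-- Y p < k, and where it decreases, k < Y p; so k lies strictly inside the
-- range of labels and is itself a label. But Y p = k forces X (s p) = X p,
-- and X (s p) = k forces Y p = X p, contradicting injectivity.
module Submission where

open import Defs
open import Data.Nat using (ℕ; _≤_)
open import Data.Product using (_×_)
open import Relation.Nullary using (¬_)

open import Algebra.Bundles using (AbelianGroup)
import Algebra.Properties.Group as GroupProperties
open import Data.Bool using (if_then_else_)
open import Data.Empty using (⊥)
open import Data.Fin using (Fin; zero; suc; toℕ; fromℕ<; _≟_)
open import Data.Fin.Properties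
  using (suc-injective; toℕ-injective; toℕ-fromℕ<; toℕ<n; toℕ≤pred[n])
open import Data.Integer as ℤ using (ℤ; +[1+_]; _+_; _<_)
import Data.Integer.Properties as ℤ
open import Data.List using (allFin)
open import Data.List.Extrema ℤ.≤-totalOrder
  using (argmax; argmin; f[xs]≤f[argmax]; f[argmin]≤f[xs])
open import Data.List.Membership.Propositional.Properties using (∈-allFin)
import Data.List.Relation.Unary.All as All
import Data.Nat as ℕ
open import Data.Nat.DivMod
  using (_%_; _mod_; %-distribˡ-+; m%n%n≡m%n; [m+n]%n≡m%n; n%n≡0; m<n⇒m%n≡m)
import Data.Nat.Properties as ℕ
open import Data.Product using (∃; _,_; map₂)
open import Data.Sum using (_⊎_; inj₁; inj₂)
import Data.Sum as Sum
open import Data.Sum.Properties using (inj₁-injective; inj₂-injective)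
open import Function using (_∘_)
open import Function.Bundles using (Bijection)
open import Function.Definitions using (Injective)
open import Relation.Binary.PropositionalEquality
open import Relation.Nullary using (yes; no; does)
open import Relation.Nullary.Decidable using (dec-true; dec-false)

open GroupProperties (AbelianGroup.group ℤ.+-0-abelianGroup)
  using (∙-cancelˡ; ∙-cancelʳ; //-rightDividesˡ; //-rightDividesʳ)

m-n≡k⇒m≡k+n : ∀ {m n k} → m ℤ.- n ≡ k → m ≡ k + n
m-n≡k⇒m≡k+n {m} {n} refl = sym (//-rightDividesˡ n m)

+-cancelʳ-< : ∀ {i j} k → i + k < j + k → i < j
+-cancelʳ-< {i} {j} k lt =
  subst₂ _<_ (//-rightDividesʳ k i) (//-rightDividesʳ k j) (ℤ.+-monoˡ-< (ℤ.- k) lt)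

module _ {m : ℕ} (X : Fin (ℕ.suc m) → ℤ) where

  maximum-attained : ∃ λ x → ∀ j → X j ℤ.≤ X x
  maximum-attained = argmax X zero (allFin _) , λ j →
    All.lookup (f[xs]≤f[argmax] {f = X} zero (allFin _)) (∈-allFin j)

  minimum-attained : ∃ λ x → ∀ j → X x ℤ.≤ X j
  minimum-attained = argmin X zero (allFin _) , λ j →
    All.lookup (f[argmin]≤f[xs] {f = X} zero (allFin _)) (∈-allFin j)

module _ {m : ℕ} {X : Fin (ℕ.suc m) → ℤ} (X-injective : Injective _≡_ _≡_ X)
         {s t : Fin (ℕ.suc m) → Fin (ℕ.suc m)} (s∘t : ∀ x → s (t x) ≡ x)
         (s-moves : ∀ p → s p ≢ p) where

  private
    X-moves : ∀ p → X p ≢ X (s p)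
    X-moves p eq = s-moves p (sym (X-injective eq))

  rises-somewhere : ∃ λ p → X p < X (s p)
  rises-somewhere with maximum-attained X
  ... | x , max = t x , ℤ.≤∧≢⇒< X[tx]≤X[stx] (X-moves (t x))
    where
    X[tx]≤X[stx] : X (t x) ℤ.≤ X (s (t x))
    X[tx]≤X[stx] = subst (X (t x) ℤ.≤_) (cong X (sym (s∘t x))) (max (t x))

  falls-somewhere : ∃ λ p → X (s p) < X p
  falls-somewhere with minimum-attained X
  ... | x , min = t x , ℤ.≤∧≢⇒< X[stx]≤X[tx] (X-moves (t x) ∘ sym)
    where
    X[stx]≤X[tx] : X (s (t x)) ℤ.≤ X (t x)
    X[stx]≤X[tx] = subst (ℤ._≤ X (t x)) (cong X (sym (s∘t x))) (min (t x))

module Balanced {m : ℕ} (X Y : Fin (ℕ.suc m) → ℤ) (s : Fin (ℕ.suc m) → Fin (ℕ.suc m))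
                (k : ℤ) (balance : ∀ p → Y p + X (s p) ≡ k + X p) where

  Y<k-at-rise : ∀ {p} → X p < X (s p) → Y p < k
  Y<k-at-rise {p} rise = +-cancelʳ-< (X p) (begin-strict
    Y p + X p      <⟨ ℤ.+-monoʳ-< (Y p) rise ⟩
    Y p + X (s p)  ≡⟨ balance p ⟩
    k + X p        ∎)
    where open ℤ.≤-Reasoning

  k<Y-at-fall : ∀ {p} → X (s p) < X p → k < Y p
  k<Y-at-fall {p} fall = +-cancelʳ-< (X p) (begin-strict
    k + X p        ≡⟨ balance p ⟨
    Y p + X (s p)  <⟨ ℤ.+-monoʳ-< (Y p) fall ⟩
    Y p + X p      ∎)
    where open ℤ.≤-Reasoning

  Y≡k⇒X-fixed : ∀ {p} → Y p ≡ k → X (s p) ≡ X p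
  Y≡k⇒X-fixed {p} refl = ∙-cancelˡ (Y p) _ _ (balance p)

  X∘s≡k⇒Y≡X : ∀ {p} → X (s p) ≡ k → Y p ≡ X p
  X∘s≡k⇒Y≡X {p} eq = ∙-cancelʳ k _ _ (begin
    Y p + k        ≡⟨ cong (Y p +_) eq ⟨
    Y p + X (s p)  ≡⟨ balance p ⟩
    k + X p        ≡⟨ ℤ.+-comm k (X p) ⟩
    X p + k        ∎)
    where open ≡-Reasoning

  module _ (X-injective : Injective _≡_ _≡_ X) (X≢Y : ∀ p → X p ≢ Y p)
           (t : Fin (ℕ.suc m) → Fin (ℕ.suc m)) (s∘t : ∀ x → s (t x) ≡ x)
           (s-moves : ∀ p → s p ≢ p) where

    k-unlabelled : ¬ ((∃ λ j → X j ≡ k) ⊎ (∃ λ i → Y i ≡ k))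
    k-unlabelled (inj₁ (j , Xj≡k)) =
      X≢Y (t j) (sym (X∘s≡k⇒Y≡X (trans (cong X (s∘t j)) Xj≡k)))
    k-unlabelled (inj₂ (i , Yi≡k)) = s-moves i (X-injective (Y≡k⇒X-fixed Yi≡k))

    no-balanced-labeling :
      (lo hi : ℤ) → (∀ p → lo ℤ.≤ Y p) → (∀ p → Y p ℤ.≤ hi) →
      (∀ v → lo ℤ.≤ v → v ℤ.≤ hi → (∃ λ j → X j ≡ v) ⊎ (∃ λ i → Y i ≡ v)) → ⊥
    no-balanced-labeling lo hi lo≤Y Y≤hi labelled = k-unlabelled (labelled k lo≤k k≤hi)
      where
      lo≤k : lo ℤ.≤ k
      lo≤k with map₂ Y<k-at-rise (rises-somewhere X-injective s∘t s-moves)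
      ... | p , Yp<k = ℤ.<⇒≤ (ℤ.≤-<-trans (lo≤Y p) Yp<k)
      k≤hi : k ℤ.≤ hi
      k≤hi with map₂ k<Y-at-fall (falls-somewhere X-injective s∘t s-moves)
      ... | p , k<Yp = ℤ.<⇒≤ (ℤ.<-≤-trans k<Yp (Y≤hi p))

[m+n%d]%d≡[m+n]%d : ∀ m n d .{{_ : ℕ.NonZero d}} → (m ℕ.+ n % d) % d ≡ (m ℕ.+ n) % d
[m+n%d]%d≡[m+n]%d m n d = begin
  (m ℕ.+ n % d) % d          ≡⟨ %-distribˡ-+ m (n % d) d ⟩
  (m % d ℕ.+ n % d % d) % d  ≡⟨ cong (λ r → (m % d ℕ.+ r) % d) (m%n%n≡m%n n d) ⟩
  (m % d ℕ.+ n % d) % d      ≡⟨ %-distribˡ-+ m n d ⟨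
  (m ℕ.+ n) % d              ∎
  where open ≡-Reasoning

[m%d+n]%d≡[m+n]%d : ∀ m n d .{{_ : ℕ.NonZero d}} → (m % d ℕ.+ n) % d ≡ (m ℕ.+ n) % d
[m%d+n]%d≡[m+n]%d m n d = begin
  (m % d ℕ.+ n) % d          ≡⟨ %-distribˡ-+ (m % d) n d ⟩
  (m % d % d ℕ.+ n % d) % d  ≡⟨ cong (λ r → (r ℕ.+ n % d) % d) (m%n%n≡m%n m d) ⟩
  (m % d ℕ.+ n % d) % d      ≡⟨ %-distribˡ-+ m n d ⟨
  (m ℕ.+ n) % d              ∎
  where open ≡-Reasoning

prev : ∀ {m} → Fin (ℕ.suc m) → Fin (ℕ.suc m)
prev {m} i = (toℕ i ℕ.+ m) mod ℕ.suc m

module _ {m : ℕ} where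

  private
    n : ℕ
    n = ℕ.suc m

  toℕ-next : (i : Fin n) → toℕ (next i) ≡ ℕ.suc (toℕ i) % n
  toℕ-next i = toℕ-fromℕ< _

  toℕ-prev : (i : Fin n) → toℕ (prev i) ≡ (toℕ i ℕ.+ m) % n
  toℕ-prev i = toℕ-fromℕ< _

  [1+i+m]%[1+m]≡i : (i : Fin n) → ℕ.suc (toℕ i ℕ.+ m) % n ≡ toℕ i
  [1+i+m]%[1+m]≡i i = begin
    ℕ.suc (toℕ i ℕ.+ m) % n  ≡⟨ cong (_% n) (ℕ.+-suc (toℕ i) m) ⟨
    (toℕ i ℕ.+ n) % n        ≡⟨ [m+n]%n≡m%n (toℕ i) n ⟩
    toℕ i % n                ≡⟨ m<n⇒m%n≡m (toℕ<n i) ⟩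
    toℕ i                    ∎
    where open ≡-Reasoning

  next-prev : (i : Fin n) → next (prev i) ≡ i
  next-prev i = toℕ-injective (begin
    toℕ (next (prev i))            ≡⟨ toℕ-next (prev i) ⟩
    ℕ.suc (toℕ (prev i)) % n       ≡⟨ cong (λ r → ℕ.suc r % n) (toℕ-prev i) ⟩
    (1 ℕ.+ (toℕ i ℕ.+ m) % n) % n  ≡⟨ [m+n%d]%d≡[m+n]%d 1 (toℕ i ℕ.+ m) n ⟩
    ℕ.suc (toℕ i ℕ.+ m) % n        ≡⟨ [1+i+m]%[1+m]≡i i ⟩
    toℕ i                          ∎)
    where open ≡-Reasoning

  prev-next : (i : Fin n) → prev (next i) ≡ i
  prev-next i = toℕ-injective (begin
    toℕ (prev (next i))              ≡⟨ toℕ-prev (next i) ⟩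
    (toℕ (next i) ℕ.+ m) % n         ≡⟨ cong (λ r → (r ℕ.+ m) % n) (toℕ-next i) ⟩
    (ℕ.suc (toℕ i) % n ℕ.+ m) % n    ≡⟨ [m%d+n]%d≡[m+n]%d (ℕ.suc (toℕ i)) m n ⟩
    ℕ.suc (toℕ i ℕ.+ m) % n          ≡⟨ [1+i+m]%[1+m]≡i i ⟩
    toℕ i                            ∎)
    where open ≡-Reasoning

  next-moves : 1 ≤ m → (i : Fin n) → next i ≢ i
  next-moves 1≤m i eq with toℕ i ℕ.<? m
  ... | yes i<m = ℕ.1+n≢n (begin
    ℕ.suc (toℕ i)      ≡⟨ m<n⇒m%n≡m (ℕ.s≤s i<m) ⟨
    ℕ.suc (toℕ i) % n  ≡⟨ toℕ-next i ⟨
    toℕ (next i)       ≡⟨ cong toℕ eq ⟩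
    toℕ i              ∎)
    where open ≡-Reasoning
  ... | no i≮m = ℕ.<⇒≢ 1≤m (begin
    0                  ≡⟨ n%n≡0 n ⟨
    n % n              ≡⟨ cong (λ r → ℕ.suc r % n) i≡m ⟨
    ℕ.suc (toℕ i) % n  ≡⟨ toℕ-next i ⟨
    toℕ (next i)       ≡⟨ cong toℕ eq ⟩
    toℕ i              ≡⟨ i≡m ⟩
    m                  ∎)
    where
    open ≡-Reasoning
    i≡m : toℕ i ≡ m
    i≡m = ℕ.≤-antisym (toℕ≤pred[n] i) (ℕ.≮⇒≥ i≮m)

  prev-moves : 1 ≤ m → (i : Fin n) → prev i ≢ i
  prev-moves 1≤m i eq = next-moves 1≤m i (trans (cong next (sym eq)) (next-prev i))

sumFin-zero : ∀ n (h : Fin n → ℤ) → (∀ a → h a ≡ ℤ.0ℤ) → sumFin n h ≡ ℤ.0ℤ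
sumFin-zero ℕ.zero    h h≡0 = refl
sumFin-zero (ℕ.suc n) h h≡0 = cong₂ _+_ (h≡0 zero) (sumFin-zero n (h ∘ suc) (h≡0 ∘ suc))

sumFin-supported : ∀ n (h : Fin n → ℤ) (p : Fin n) →
                   (∀ a → a ≢ p → h a ≡ ℤ.0ℤ) → sumFin n h ≡ h p
sumFin-supported (ℕ.suc n) h zero h≡0 = begin
  h zero + sumFin n (h ∘ suc)  ≡⟨ cong (h zero +_) (sumFin-zero n (h ∘ suc) h∘suc≡0) ⟩
  h zero + ℤ.0ℤ                ≡⟨ ℤ.+-identityʳ (h zero) ⟩
  h zero                       ∎
  where
  open ≡-Reasoning
  h∘suc≡0 : ∀ a → h (suc a) ≡ ℤ.0ℤ
  h∘suc≡0 a = h≡0 (suc a) λ ()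
sumFin-supported (ℕ.suc n) h (suc p) h≡0 = begin
  h zero + sumFin n (h ∘ suc)  ≡⟨ cong₂ _+_ (h≡0 zero λ ()) (sumFin-supported n _ p h∘suc≡0) ⟩
  ℤ.0ℤ + h (suc p)             ≡⟨ ℤ.+-identityˡ (h (suc p)) ⟩
  h (suc p)                    ∎
  where
  open ≡-Reasoning
  h∘suc≡0 : ∀ a → a ≢ p → h (suc a) ≡ ℤ.0ℤ
  h∘suc≡0 a a≢p = h≡0 (suc a) (a≢p ∘ suc-injective)

sumFin-select : ∀ {n v} (P : Fin n → Fin v) (x : Fin v) (g : Fin n → ℤ) {p : Fin n} →
                P p ≡ x → (∀ a → P a ≡ x → a ≡ p) →
                sumFin n (λ a → if does (P a ≟ x) then g a else ℤ.0ℤ) ≡ g p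
sumFin-select {n} P x g {p} Pp≡x unique =
  trans (sumFin-supported n _ p outside) (cong (if_then g p else ℤ.0ℤ) (dec-true (P p ≟ x) Pp≡x))
  where
  outside : ∀ a → a ≢ p → (if does (P a ≟ x) then g a else ℤ.0ℤ) ≡ ℤ.0ℤ
  outside a a≢p = cong (if_then g a else ℤ.0ℤ) (dec-false (P a ≟ x) (a≢p ∘ unique a))

module _ (G : Digraph) (f : TotalLabeling G) where

  label-injective : Injective _≡_ _≡_ (label G f)
  label-injective eq = Bijection.injective f (toℕ-injective (ℕ.suc-injective (ℤ.+-injective eq)))

  1≤label : ∀ e → ℤ.+ 1 ℤ.≤ label G f e
  1≤label e = ℤ.+≤+ (ℕ.s≤s ℕ.z≤n)

  label≤size : ∀ e → label G f e ℤ.≤ ℤ.+ (nV G ℕ.+ nA G)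
  label≤size e = ℤ.+≤+ (toℕ<n (Bijection.to f e))

  label-surjective : ∀ v → ℤ.+ 1 ℤ.≤ v → v ℤ.≤ ℤ.+ (nV G ℕ.+ nA G) → ∃ λ e → label G f e ≡ v
  label-surjective (ℤ.+ 0) (ℤ.+≤+ ()) _
  label-surjective +[1+ j ] _ (ℤ.+≤+ j<size) with Bijection.strictlySurjective f (fromℕ< j<size)
  ... | e , to-e = e , cong (λ i → +[1+ i ]) (trans (cong toℕ to-e) (toℕ-fromℕ< j<size))

module DicycleLabeling {m : ℕ} (f : TotalLabeling (dicycle (ℕ.suc m))) where

  C : Digraph
  C = dicycle (ℕ.suc m)

  vertexLabel arcLabel : Fin (ℕ.suc m) → ℤ
  vertexLabel x = label C f (inj₁ x)
  arcLabel    a = label C f (inj₂ a)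

  vertexLabel-injective : Injective _≡_ _≡_ vertexLabel
  vertexLabel-injective = inj₁-injective ∘ label-injective C f

  arcLabel-injective : Injective _≡_ _≡_ arcLabel
  arcLabel-injective = inj₂-injective ∘ label-injective C f

  vertexLabel≢arcLabel : ∀ x a → vertexLabel x ≢ arcLabel a
  vertexLabel≢arcLabel x a eq with label-injective C f eq
  ... | ()

  labelled : ∀ v → ℤ.+ 1 ℤ.≤ v → v ℤ.≤ ℤ.+ (nV C ℕ.+ nA C) →
             (∃ λ x → vertexLabel x ≡ v) ⊎ (∃ λ a → arcLabel a ≡ v)
  labelled v 1≤v v≤size with label-surjective C f v 1≤v v≤size
  ... | inj₁ x , eq = inj₁ (x , eq)
  ... | inj₂ a , eq = inj₂ (a , eq)

  vertexWt-dicycle : ∀ x → vertexWt C f x ≡ (vertexLabel x + arcLabel (prev x)) ℤ.- arcLabel x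
  vertexWt-dicycle x = cong₂ (λ i o → (vertexLabel x + i) ℤ.- o)
    (sumFin-select next x arcLabel (next-prev x) (λ a eq → trans (sym (prev-next a)) (cong prev eq)))
    (sumFin-select (λ a → a) x arcLabel refl (λ a eq → eq))

dicycle-has-no-SAML : ∀ {m} → 1 ≤ m → ¬ SAML (dicycle (ℕ.suc m))
dicycle-has-no-SAML 1≤m (f , k , constant) =
  Balanced.no-balanced-labeling vertexLabel arcLabel next k (m-n≡k⇒m≡k+n ∘ constant)
    vertexLabel-injective (λ p → vertexLabel≢arcLabel p p) prev next-prev (next-moves 1≤m)
    (ℤ.+ 1) _ (1≤label C f ∘ inj₂) (label≤size C f ∘ inj₂) labelled
  where open DicycleLabeling f

dicycle-has-no-SVML : ∀ {m} → 1 ≤ m → ¬ SVML (dicycle (ℕ.suc m))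
dicycle-has-no-SVML 1≤m (f , k , constant) =
  Balanced.no-balanced-labeling arcLabel vertexLabel prev k
    (λ x → m-n≡k⇒m≡k+n (trans (sym (vertexWt-dicycle x)) (constant x)))
    arcLabel-injective (λ p → vertexLabel≢arcLabel p p ∘ sym) next prev-next (prev-moves 1≤m)
    (ℤ.+ 1) _ (1≤label C f ∘ inj₁) (label≤size C f ∘ inj₁)
    (λ v 1≤v v≤size → Sum.swap (labelled v 1≤v v≤size))
  where open DicycleLabeling f

mainTheorem5 : (n : ℕ) → 3 ≤ n → ¬ SAML (dicycle n) × ¬ SVML (dicycle n)
mainTheorem5 (ℕ.suc n) (ℕ.s≤s 1<n) =
  dicycle-has-no-SAML (ℕ.<⇒≤ 1<n) , dicycle-has-no-SVML (ℕ.<⇒≤ 1<n)
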